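{- Let $P$ be a poset on $\{1,\ldots,n\}$ and let $M$ be a maximum independent set of $G_P$. Then the poset $F_M$ is a $P$-forest.
   Context: An order ideal of $P$ is a subset $J$ with $i\in J$, $j\le_P i\Rightarrow j\in J$; a nonempty order ideal is connected if the Hasse diagram of $P$ restricted to it is connected. Sets $A,B$ intersect nontrivially if $A\cap B\ne\emptyset$, $A\not\subseteq B$, $B\not\subseteq A$. $G_P$ is the simple graph whose vertices are the connected order ideals of $P$, adjacent iff they intersect nontrivially. A maximum independent set is an independent set of largest possible size. For $J\in M$, $\mu(M,J)=\bigcup_{J'\in M,\,J'\subsetneq J}J'$; each $J\setminus\mu(M,J)$ is a singleton and distinct $J$ give distinct singletons covering $[n]$ (fact from the paper); $J_i$ denotes the element of $M$ with $J_i\setminus\mu(M,J_i)=\{i\}$. $F_M$ is the poset on $[n]$ with $i<_{F_M}j$ iff $J_i\subsetneq J_j$. For a poset $F$ on $[n]$, $\Lambda_i^F=\{j:j\le_F i\}$. A $P$-forest is a poset $F$ on $[n]$ in which each element is covered by at most one element, such that each $\Lambda_i^F$ is a connected order ideal of $P$ and, for $i,j$ incomparable in $F$, $\Lambda_i^F\cup\Lambda_j^F$ is a disconnected order ideal of $P$. -}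

module Defs where

open import Level using (0ℓ)
open import Data.Nat using (ℕ; _≤_)
open import Data.Fin using (Fin)
open import Data.Fin.Subset using (Subset; _∈_; _⊆_; _⊂_)
open import Data.List using (List; length)
import Data.List.Membership.Propositional as L
open import Data.List.Relation.Unary.All using (All)
open import Data.List.Relation.Unary.Unique.Propositional using (Unique)
open import Data.Product using (Σ; ∃; ∃-syntax; _×_; _,_)
open import Data.Sum using (_⊎_)
open import Relation.Nullary using (¬_)
open import Relation.Unary using (Pred)
open import Relation.Binary using (Rel; IsPartialOrder)
open import Relation.Binary.PropositionalEquality using (_≡_; _≢_)

record FinPoset (n : ℕ) : Set₁ where
  field
    _≤P_ : Rel (Fin n) 0ℓ
    isPartialOrder : IsPartialOrder _≡_ _≤P_

module _ {n : ℕ} where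

  Strict : Rel (Fin n) 0ℓ → Rel (Fin n) 0ℓ
  Strict R i j = R i j × i ≢ j

  Covers : Rel (Fin n) 0ℓ → Rel (Fin n) 0ℓ
  Covers R i j = Strict R i j × ¬ (∃[ k ] (Strict R i k × Strict R k j))

  HasseEdge : Rel (Fin n) 0ℓ → Rel (Fin n) 0ℓ
  HasseEdge R i j = Covers R i j ⊎ Covers R j i

  -- walks in the Hasse diagram all of whose vertices after the first lie in U
  data Walk (R : Rel (Fin n) 0ℓ) (U : Pred (Fin n) 0ℓ) : Fin n → Fin n → Set where
    stop : ∀ {i} → Walk R U i i
    step : ∀ {i j k} → HasseEdge R i j → U j → Walk R U j k → Walk R U i k

  IsOrderIdeal : Rel (Fin n) 0ℓ → Pred (Fin n) 0ℓ → Set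
  IsOrderIdeal R U = ∀ i j → U i → R j i → U j

  HasseConnected : Rel (Fin n) 0ℓ → Pred (Fin n) 0ℓ → Set
  HasseConnected R U = ∀ i j → U i → U j → Walk R U i j

  IsConnectedOrderIdeal : Rel (Fin n) 0ℓ → Pred (Fin n) 0ℓ → Set
  IsConnectedOrderIdeal R U = (∃[ i ] U i) × IsOrderIdeal R U × HasseConnected R U

  IsDisconnectedOrderIdeal : Rel (Fin n) 0ℓ → Pred (Fin n) 0ℓ → Set
  IsDisconnectedOrderIdeal R U = (∃[ i ] U i) × IsOrderIdeal R U × ¬ HasseConnected R U

  ⟦_⟧ : Subset n → Pred (Fin n) 0ℓ
  ⟦ A ⟧ i = i ∈ A

  IntersectNontrivially : Subset n → Subset n → Set
  IntersectNontrivially A B = (∃[ i ] (i ∈ A × i ∈ B)) × ¬ (A ⊆ B) × ¬ (B ⊆ A)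

  -- independent sets of G_P: duplicate-free lists of connected order ideals,
  -- pairwise not intersecting nontrivially
  IsIndependentSet : FinPoset n → List (Subset n) → Set
  IsIndependentSet P M =
    Unique M
    × All (λ J → IsConnectedOrderIdeal (FinPoset._≤P_ P) ⟦ J ⟧) M
    × (∀ A B → A L.∈ M → B L.∈ M → ¬ IntersectNontrivially A B)

  IsMaximumIndependentSet : FinPoset n → List (Subset n) → Set
  IsMaximumIndependentSet P M =
    IsIndependentSet P M × (∀ M' → IsIndependentSet P M' → length M' ≤ length M)

  μ : List (Subset n) → Subset n → Pred (Fin n) 0ℓ
  μ M J i = ∃[ J' ] (J' L.∈ M × J' ⊂ J × i ∈ J')

  -- J ∖ μ(M,J) = {i}
  Label : List (Subset n) → Subset n → Fin n → Set
  Label M J i = ∀ k → ((k ∈ J × ¬ μ M J k) → k ≡ i) × (k ≡ i → (k ∈ J × ¬ μ M J k))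

  _<[F_]_ : Fin n → List (Subset n) → Fin n → Set
  i <[F M ] j = ∃[ Ji ] ∃[ Jj ] (Ji L.∈ M × Jj L.∈ M × Label M Ji i × Label M Jj j × Ji ⊂ Jj)

  ≤F : List (Subset n) → Rel (Fin n) 0ℓ
  ≤F M i j = i ≡ j ⊎ i <[F M ] j

  Λ : Rel (Fin n) 0ℓ → Fin n → Pred (Fin n) 0ℓ
  Λ F i j = F j i

  IsPForest : FinPoset n → Rel (Fin n) 0ℓ → Set
  IsPForest P F =
    IsPartialOrder _≡_ F
    × (∀ i j k → Covers F i j → Covers F i k → j ≡ k)
    × (∀ i → IsConnectedOrderIdeal (FinPoset._≤P_ P) (Λ F i))
    × (∀ i j → ¬ F i j → ¬ F j i →
         IsDisconnectedOrderIdeal (FinPoset._≤P_ P) (λ k → Λ F i k ⊎ Λ F j k))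

-- Every i ∈ [n] is the label of exactly one member of M.  For existence,
-- take the hull of i: the down-set ↓i together with every member of M
-- that meets ↓i but avoids i.  It is a connected order ideal nested with
-- every member of M, so by maximality it belongs to M, and its label is i.
-- Hence j ≤_F i ⇔ j ∈ J_i ⇔ J_j ⊆ J_i, i.e. F_M is inclusion on the
-- laminar family M: this makes F_M a forest with Λ_i = J_i, and for
-- incomparable i, j the order ideals J_i, J_j are disjoint, so no Hasse
-- walk inside J_i ∪ J_j leaves J_i.  As ≤_P is not assumed decidable, the
-- hull is only built under a double negation; this suffices because having
-- a label is a decidable property.
module Submission where

open import Defs
open import Level using (0ℓ)
open import Data.Nat using (ℕ; suc; _≤_; _<_; s≤s)
open import Data.Nat.Properties using (≤-trans; ≤-refl; <-irrefl)
open import Data.Bool.Properties using (T-≡) renaming (_≟_ to _≟ᵇ_)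
open import Data.Fin using (Fin)
open import Data.Fin.Properties using (_≟_; any?; all?; ¬∀⟶∃¬; sequence)
open import Data.Fin.Subset using (Subset; _∈_; _∉_; _⊆_; _⊂_; ∣_∣)
open import Data.Fin.Subset.Properties
  using (_∈?_; _⊆?_; _⊂?_; ⊆-reflexive; ⊆-trans; ⊆-antisym; p⊂q⇒p⊆q; p⊂q⇒∣p∣<∣q∣)
open import Data.List using (List; _∷_; length)
import Data.List.Membership.Propositional as L
open import Data.List.Membership.Propositional using (find; lose)
open import Data.List.Relation.Unary.Any using (here; there) renaming (any? to anyᴸ?)
open import Data.List.Relation.Unary.All as All using (All; _∷_)
open import Data.List.Relation.Unary.All.Properties using (¬Any⇒All¬)
open import Data.List.Relation.Unary.AllPairs using (_∷_)
open import Data.List.Relation.Unary.Unique.Propositional using (Unique)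
open import Data.Vec using (tabulate)
open import Data.Vec.Properties using (≡-dec; lookup⇒[]=; []=⇒lookup; lookup∘tabulate)
open import Data.Product using (∃-syntax; _×_; _,_; proj₁; proj₂)
open import Data.Sum using (_⊎_; inj₁; inj₂; [_,_]; swap)
import Data.Sum as Sum
open import Data.Empty using (⊥-elim)
open import Effect.Applicative using (RawApplicative)
open import Effect.Monad using (RawMonad)
open import Function using (id; _∘_; Equivalence)
open import Relation.Nullary using (¬_; Dec; yes; no; ¬?)
open import Relation.Nullary.Decidable
  using (_×-dec_; _⊎-dec_; _→-dec_; ⌊_⌋; toWitness; fromWitness; decidable-stable; ¬¬-excluded-middle; map′)
open import Relation.Nullary.Negation using (DoubleNegation; ¬¬-Monad)
open import Relation.Binary using (Rel; Decidable; IsPartialOrder)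
open import Relation.Binary.PropositionalEquality using (_≡_; _≢_; refl; sym; subst; isEquivalence) renaming (trans to ≡-trans)
open import Relation.Unary using (Pred; _∪_; _≐_) renaming (_⊆_ to _⇒_)
open import Relation.Unary.Properties using (≐-sym)

module _ {A : Set} {Q : Pred A 0ℓ} where

  any∈? : (∀ x → Dec (Q x)) → (xs : List A) → Dec (∃[ x ] (x L.∈ xs × Q x))
  any∈? Q? xs = map′ find (λ (_ , x∈xs , q) → lose x∈xs q) (anyᴸ? Q? xs)

¬¬-decidable : ∀ {n} (R : Rel (Fin n) 0ℓ) → ¬ ¬ Decidable R
¬¬-decidable R = sequence ¬¬-applicative (λ a → sequence ¬¬-applicative (λ b → ¬¬-excluded-middle))
  where
  ¬¬-applicative : RawApplicative {0ℓ} DoubleNegation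
  ¬¬-applicative = RawMonad.rawApplicative ¬¬-Monad

module _ {n : ℕ} where

  _≟ₛ_ : (A B : Subset n) → Dec (A ≡ B)
  _≟ₛ_ = ≡-dec _≟ᵇ_

  ⊆∧≢⇒⊂ : {A B : Subset n} → A ⊆ B → A ≢ B → A ⊂ B
  ⊆∧≢⇒⊂ {A} {B} A⊆B A≢B with B ⊆? A
  ... | yes B⊆A = ⊥-elim (A≢B (⊆-antisym A⊆B B⊆A))
  ... | no B⊈A with ¬∀⟶∃¬ n (λ x → x ∈ B → x ∈ A) (λ x → (x ∈? B) →-dec (x ∈? A)) (λ f → B⊈A (f _))
  ... | x , x∈B⇏x∈A with x ∈? B
  ...   | yes x∈B = A⊆B , x , x∈B , (λ x∈A → x∈B⇏x∈A (λ _ → x∈A))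
  ...   | no x∉B = ⊥-elim (x∈B⇏x∈A (⊥-elim ∘ x∉B))

  fromDecidable : {Q : Pred (Fin n) 0ℓ} → (∀ j → Dec (Q j)) → Subset n
  fromDecidable Q? = tabulate (λ j → ⌊ Q? j ⌋)

  module _ {Q : Pred (Fin n) 0ℓ} (Q? : ∀ j → Dec (Q j)) where

    ∈-fromDecidable⁺ : ∀ {j} → Q j → j ∈ fromDecidable Q?
    ∈-fromDecidable⁺ {j} q = lookup⇒[]= j _ (≡-trans
      (lookup∘tabulate (λ j → ⌊ Q? j ⌋) j) (Equivalence.to T-≡ (fromWitness q)))

    ∈-fromDecidable⁻ : ∀ {j} → j ∈ fromDecidable Q? → Q j
    ∈-fromDecidable⁻ {j} j∈ = toWitness (Equivalence.from T-≡ (≡-trans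
      (sym (lookup∘tabulate (λ j → ⌊ Q? j ⌋) j)) ([]=⇒lookup j∈)))

  ¬IntersectNontrivially-refl : (A : Subset n) → ¬ IntersectNontrivially A A
  ¬IntersectNontrivially-refl A (_ , A⊈A , _) = A⊈A id

  nested⇒¬IntersectNontrivially : {A B : Subset n} →
    (∀ {w} → w ∈ A → w ∈ B → A ⊆ B ⊎ B ⊆ A) → ¬ IntersectNontrivially A B
  nested⇒¬IntersectNontrivially nested ((w , w∈A , w∈B) , A⊈B , B⊈A) =
    [ A⊈B , B⊈A ] (nested w∈A w∈B)

  label? : (M : List (Subset n)) → ∀ J i → Dec (Label M J i)
  label? M J i = all? (λ k → ((k∈J∖μ? k) →-dec (k ≟ i)) ×-dec ((k ≟ i) →-dec (k∈J∖μ? k)))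
    where
    k∈J∖μ? : ∀ k → Dec (k ∈ J × ¬ μ M J k)
    k∈J∖μ? k = (k ∈? J) ×-dec ¬? (any∈? (λ J′ → (J′ ⊂? J) ×-dec (k ∈? J′)) M)

module _ {n : ℕ} {R : Rel (Fin n) 0ℓ} where

  _◅◅_ : ∀ {U a b c} → Walk R U a b → Walk R U b c → Walk R U a c
  stop ◅◅ w′ = w′
  step e u w ◅◅ w′ = step e u (w ◅◅ w′)

  Walk-map : ∀ {U V a b} → U ⇒ V → Walk R U a b → Walk R V a b
  Walk-map U⇒V stop = stop
  Walk-map U⇒V (step e u w) = step e (U⇒V u) (Walk-map U⇒V w)

  Walk-reverse : ∀ {U a b} → U a → Walk R U a b → Walk R U b a
  Walk-reverse ua stop = stop
  Walk-reverse ua (step e ub w) = Walk-reverse ub w ◅◅ step (swap e) ua stop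

  IsConnectedOrderIdeal-resp-≐ : ∀ {U V} → U ≐ V → IsConnectedOrderIdeal R U → IsConnectedOrderIdeal R V
  IsConnectedOrderIdeal-resp-≐ (U⇒V , V⇒U) ((x , ux) , ideal , connected) =
    (x , U⇒V ux) , (λ i j vi ji → U⇒V (ideal i j (V⇒U vi) ji)) ,
    (λ i j vi vj → Walk-map U⇒V (connected i j (V⇒U vi) (V⇒U vj)))

  Walk-stays-in-ideal : ∀ {A B a b} → IsOrderIdeal R A → IsOrderIdeal R B →
    (∀ {k} → A k → ¬ B k) → A a → Walk R (A ∪ B) a b → A b
  Walk-stays-in-ideal idealA idealB disjoint a∈A stop = a∈A
  Walk-stays-in-ideal {A} {B} idealA idealB disjoint a∈A (step e c∈A∪B w) =
    Walk-stays-in-ideal idealA idealB disjoint (next e c∈A∪B) w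
    where
    next : ∀ {c} → HasseEdge R _ c → (A ∪ B) c → A c
    next _ (inj₁ c∈A) = c∈A
    next (inj₁ a⋖c) (inj₂ c∈B) = ⊥-elim (disjoint a∈A (idealB _ _ c∈B (proj₁ (proj₁ a⋖c))))
    next (inj₂ c⋖a) (inj₂ c∈B) = idealA _ _ a∈A (proj₁ (proj₁ c⋖a))

  Covers⇒no-middle : ∀ {i j k} → Covers R i k → Strict R i j → R j k → j ≡ k
  Covers⇒no-middle {i} {j} {k} (_ , no-middle) i<j j≤k with j ≟ k
  ... | yes j≡k = j≡k
  ... | no j≢k = ⊥-elim (no-middle (j , i<j , j≤k , j≢k))

module HasseWalk {n : ℕ} {_⊑_ : Rel (Fin n) 0ℓ}
                 (isPartialOrder : IsPartialOrder _≡_ _⊑_) (_⊑?_ : Decidable _⊑_) where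
  open IsPartialOrder isPartialOrder using (antisym) renaming (refl to ⊑-refl; trans to ⊑-trans)

  strict? : ∀ a b → Dec (Strict _⊑_ a b)
  strict? a b = (a ⊑? b) ×-dec ¬? (a ≟ b)

  <-≤-trans : ∀ {a b c} → Strict _⊑_ a b → b ⊑ c → Strict _⊑_ a c
  <-≤-trans (a⊑b , a≢b) b⊑c = ⊑-trans a⊑b b⊑c , λ { refl → a≢b (antisym a⊑b b⊑c) }

  InInterval : Fin n → Fin n → Pred (Fin n) 0ℓ
  InInterval a b z = Strict _⊑_ a z × z ⊑ b

  inInterval? : ∀ a b z → Dec (InInterval a b z)
  inInterval? a b z = strict? a z ×-dec (z ⊑? b)

  interval : Fin n → Fin n → Subset n
  interval a b = fromDecidable (inInterval? a b)

  module _ {a b : Fin n} where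
    ∈-interval⁺ : ∀ {z} → InInterval a b z → z ∈ interval a b
    ∈-interval⁺ = ∈-fromDecidable⁺ (inInterval? a b)

    ∈-interval⁻ : ∀ {z} → z ∈ interval a b → InInterval a b z
    ∈-interval⁻ = ∈-fromDecidable⁻ (inInterval? a b)

  module _ {a k b : Fin n} (a<k : Strict _⊑_ a k) (k<b : Strict _⊑_ k b) where

    interval-⊂ˡ : interval a k ⊂ interval a b
    interval-⊂ˡ = (λ z∈ → let (a<z , z⊑k) = ∈-interval⁻ z∈ in ∈-interval⁺ (a<z , ⊑-trans z⊑k (proj₁ k<b)))
                , b , ∈-interval⁺ (<-≤-trans a<k (proj₁ k<b) , ⊑-refl)
                , (λ b∈ → proj₂ k<b (antisym (proj₁ k<b) (proj₂ (∈-interval⁻ b∈))))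

    interval-⊂ʳ : interval k b ⊂ interval a b
    interval-⊂ʳ = (λ z∈ → let ((k⊑z , _) , z⊑b) = ∈-interval⁻ z∈ in ∈-interval⁺ (<-≤-trans a<k k⊑z , z⊑b))
                , k , ∈-interval⁺ (a<k , proj₁ k<b)
                , (λ k∈ → proj₂ (proj₁ (∈-interval⁻ k∈)) refl)

  hasse-walk-bounded : ∀ m a b → ∣ interval a b ∣ < m → a ⊑ b → Walk _⊑_ (_⊑ b) a b
  hasse-walk-bounded (suc m) a b (s≤s size<m) a⊑b with a ≟ b
  ... | yes refl = stop
  ... | no a≢b with any? (λ k → strict? a k ×-dec strict? k b)
  ... | no no-middle = step (inj₁ ((a⊑b , a≢b) , no-middle)) ⊑-refl stop
  ... | yes (k , a<k , k<b) =
    Walk-map (λ z⊑k → ⊑-trans z⊑k (proj₁ k<b))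
      (hasse-walk-bounded m a k (≤-trans (p⊂q⇒∣p∣<∣q∣ (interval-⊂ˡ a<k k<b)) size<m) (proj₁ a<k))
    ◅◅ hasse-walk-bounded m k b (≤-trans (p⊂q⇒∣p∣<∣q∣ (interval-⊂ʳ a<k k<b)) size<m) (proj₁ k<b)

  hasse-walk : ∀ {a b} → a ⊑ b → Walk _⊑_ (_⊑ b) a b
  hasse-walk {a} {b} = hasse-walk-bounded (suc ∣ interval a b ∣) a b ≤-refl

module IndependentSet {n : ℕ} (P : FinPoset n) (M : List (Subset n)) (independent : IsIndependentSet P M) where
  open FinPoset P renaming (_≤P_ to _⊑_)
  open IsPartialOrder isPartialOrder using (antisym) renaming (refl to ⊑-refl; trans to ⊑-trans)

  private
    unique : Unique M
    unique = proj₁ independent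

    connected : All (λ J → IsConnectedOrderIdeal _⊑_ ⟦ J ⟧) M
    connected = proj₁ (proj₂ independent)

    laminar : ∀ A B → A L.∈ M → B L.∈ M → ¬ IntersectNontrivially A B
    laminar = proj₂ (proj₂ independent)

  member-connected : ∀ {J} → J L.∈ M → IsConnectedOrderIdeal _⊑_ ⟦ J ⟧
  member-connected = All.lookup connected

  member-ideal : ∀ {J} → J L.∈ M → ∀ {i j} → i ∈ J → j ⊑ i → j ∈ J
  member-ideal J∈M i∈J j⊑i = proj₁ (proj₂ (member-connected J∈M)) _ _ i∈J j⊑i

  nested : ∀ {J J′ x} → J L.∈ M → J′ L.∈ M → x ∈ J → x ∈ J′ → J ⊆ J′ ⊎ J′ ⊆ J
  nested {J} {J′} {x} J∈M J′∈M x∈J x∈J′ with J ⊆? J′ | J′ ⊆? J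
  ... | yes J⊆J′ | _ = inj₁ J⊆J′
  ... | no _ | yes J′⊆J = inj₂ J′⊆J
  ... | no J⊈J′ | no J′⊈J = ⊥-elim (laminar J J′ J∈M J′∈M ((x , x∈J , x∈J′) , J⊈J′ , J′⊈J))

  module _ {J : Subset n} {i : Fin n} (label : Label M J i) where

    label-∈ : i ∈ J
    label-∈ = proj₁ (proj₂ (label i) refl)

    label-∉μ : ¬ μ M J i
    label-∉μ = proj₂ (proj₂ (label i) refl)

    label-functional : ∀ {j} → Label M J j → i ≡ j
    label-functional {j} label′ = proj₁ (label′ i) (label-∈ , label-∉μ)

    label-⊆ : ∀ {J′} → J′ L.∈ M → i ∈ J′ → J′ ⊆ J → J′ ≡ J
    label-⊆ {J′} J′∈M i∈J′ J′⊆J with J′ ≟ₛ J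
    ... | yes J′≡J = J′≡J
    ... | no J′≢J = ⊥-elim (label-∉μ (J′ , J′∈M , ⊆∧≢⇒⊂ J′⊆J J′≢J , i∈J′))

  label-injective : ∀ {J J′ i} → J L.∈ M → J′ L.∈ M → Label M J i → Label M J′ i → J ≡ J′
  label-injective J∈M J′∈M label label′ with nested J∈M J′∈M (label-∈ label) (label-∈ label′)
  ... | inj₁ J⊆J′ = label-⊆ label′ J∈M (label-∈ label) J⊆J′
  ... | inj₂ J′⊆J = sym (label-⊆ label J′∈M (label-∈ label′) J′⊆J)

  module Labelling (labelled : ∀ i → ∃[ J ] (J L.∈ M × Label M J i)) where

    J : Fin n → Subset n
    J i = proj₁ (labelled i)

    J∈M : ∀ i → J i L.∈ M
    J∈M i = proj₁ (proj₂ (labelled i))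

    J-label : ∀ i → Label M (J i) i
    J-label i = proj₂ (proj₂ (labelled i))

    J-injective : ∀ {i j} → J i ≡ J j → i ≡ j
    J-injective {i} {j} Ji≡Jj = label-functional (J-label i) (subst (λ X → Label M X j) (sym Ji≡Jj) (J-label j))

    ⊆⇒≤F : ∀ {i j} → J i ⊆ J j → ≤F M i j
    ⊆⇒≤F {i} {j} Ji⊆Jj with J i ≟ₛ J j
    ... | yes Ji≡Jj = inj₁ (J-injective Ji≡Jj)
    ... | no Ji≢Jj = inj₂ (J i , J j , J∈M i , J∈M j , J-label i , J-label j , ⊆∧≢⇒⊂ Ji⊆Jj Ji≢Jj)

    ∈⇒⊆ : ∀ {i j} → i ∈ J j → J i ⊆ J j
    ∈⇒⊆ {i} {j} i∈Jj with nested (J∈M i) (J∈M j) (label-∈ (J-label i)) i∈Jj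
    ... | inj₁ Ji⊆Jj = Ji⊆Jj
    ... | inj₂ Jj⊆Ji = ⊆-reflexive (sym (label-⊆ (J-label i) (J∈M j) i∈Jj Jj⊆Ji))

    ≤F⇒∈ : ∀ {i j} → ≤F M i j → i ∈ J j
    ≤F⇒∈ {i} (inj₁ refl) = label-∈ (J-label i)
    ≤F⇒∈ {i} {j} (inj₂ (A , B , A∈M , B∈M , labelA , labelB , A⊂B)) =
      subst (i ∈_) (label-injective B∈M (J∈M j) labelB (J-label j)) (p⊂q⇒p⊆q A⊂B (label-∈ labelA))

    ≤F⇒⊆ : ∀ {i j} → ≤F M i j → J i ⊆ J j
    ≤F⇒⊆ = ∈⇒⊆ ∘ ≤F⇒∈

    Λ≐J : ∀ i → Λ (≤F M) i ≐ ⟦ J i ⟧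
    Λ≐J i = ≤F⇒∈ , ⊆⇒≤F ∘ ∈⇒⊆

    ≤F-isPartialOrder : IsPartialOrder _≡_ (≤F M)
    ≤F-isPartialOrder = record
      { isPreorder = record
        { isEquivalence = isEquivalence
        ; reflexive = inj₁
        ; trans = λ i≤j j≤k → ⊆⇒≤F (⊆-trans (≤F⇒⊆ i≤j) (≤F⇒⊆ j≤k))
        }
      ; antisym = λ i≤j j≤i → J-injective (⊆-antisym (≤F⇒⊆ i≤j) (≤F⇒⊆ j≤i))
      }

    ≤F-comparable : ∀ {i j w} → w ∈ J i → w ∈ J j → ≤F M i j ⊎ ≤F M j i
    ≤F-comparable w∈Ji w∈Jj = Sum.map ⊆⇒≤F ⊆⇒≤F (nested (J∈M _) (J∈M _) w∈Ji w∈Jj)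

    ≤F-cover-unique : ∀ i j k → Covers (≤F M) i j → Covers (≤F M) i k → j ≡ k
    ≤F-cover-unique i j k i⋖j i⋖k with ≤F-comparable (≤F⇒∈ (proj₁ (proj₁ i⋖j))) (≤F⇒∈ (proj₁ (proj₁ i⋖k)))
    ... | inj₁ j≤k = Covers⇒no-middle i⋖k (proj₁ i⋖j) j≤k
    ... | inj₂ k≤j = sym (Covers⇒no-middle i⋖j (proj₁ i⋖k) k≤j)

    Λ-connected : ∀ i → IsConnectedOrderIdeal _⊑_ (Λ (≤F M) i)
    Λ-connected i = IsConnectedOrderIdeal-resp-≐ (≐-sym (Λ≐J i)) (member-connected (J∈M i))

    Λ-incomparable-disconnected : ∀ i j → ¬ ≤F M i j → ¬ ≤F M j i →
      IsDisconnectedOrderIdeal _⊑_ (Λ (≤F M) i ∪ Λ (≤F M) j)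
    Λ-incomparable-disconnected i j i≰j j≰i = (i , inj₁ (inj₁ refl)) , ∪-ideal , disconnected
      where
      ideal : ∀ k → IsOrderIdeal _⊑_ (Λ (≤F M) k)
      ideal k = proj₁ (proj₂ (Λ-connected k))
      ∪-ideal : IsOrderIdeal _⊑_ (Λ (≤F M) i ∪ Λ (≤F M) j)
      ∪-ideal a b a∈ b⊑a = Sum.map (λ a∈ → ideal i a b a∈ b⊑a) (λ a∈ → ideal j a b a∈ b⊑a) a∈
      disjoint : ∀ {w} → Λ (≤F M) i w → ¬ Λ (≤F M) j w
      disjoint w≤i w≤j = [ i≰j , j≰i ] (≤F-comparable (≤F⇒∈ w≤i) (≤F⇒∈ w≤j))
      disconnected : ¬ HasseConnected _⊑_ (Λ (≤F M) i ∪ Λ (≤F M) j)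
      disconnected hc = disjoint
        (Walk-stays-in-ideal (ideal i) (ideal j) disjoint (inj₁ refl) (hc i j (inj₁ (inj₁ refl)) (inj₂ (inj₁ refl))))
        (inj₁ refl)

    isPForest : IsPForest P (≤F M)
    isPForest = ≤F-isPartialOrder , ≤F-cover-unique , Λ-connected , Λ-incomparable-disconnected

  module Hull (maximum : ∀ M′ → IsIndependentSet P M′ → length M′ ≤ length M)
              (_⊑?_ : Decidable _⊑_) where
    open HasseWalk isPartialOrder _⊑?_ using (hasse-walk)

    InHull : Fin n → Pred (Fin n) 0ℓ
    InHull x j = j ⊑ x ⊎ ∃[ J ] (J L.∈ M × x ∉ J × (∃[ z ] (z ∈ J × z ⊑ x)) × j ∈ J)

    inHull? : ∀ x j → Dec (InHull x j)
    inHull? x j = (j ⊑? x) ⊎-dec any∈? (λ J → ¬? (x ∈? J) ×-dec any? (λ z → (z ∈? J) ×-dec (z ⊑? x)) ×-dec (j ∈? J)) M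

    hull : Fin n → Subset n
    hull x = fromDecidable (inHull? x)

    module _ {x : Fin n} where
      ∈-hull⁺ : ∀ {j} → InHull x j → j ∈ hull x
      ∈-hull⁺ = ∈-fromDecidable⁺ (inHull? x)

      ∈-hull⁻ : ∀ {j} → j ∈ hull x → InHull x j
      ∈-hull⁻ = ∈-fromDecidable⁻ (inHull? x)

      below⊆hull : (_⊑ x) ⇒ ⟦ hull x ⟧
      below⊆hull = ∈-hull⁺ ∘ inj₁

      x∈hull : x ∈ hull x
      x∈hull = below⊆hull ⊑-refl

    hull-⊆ : ∀ {x J} → J L.∈ M → x ∈ J → hull x ⊆ J
    hull-⊆ J∈M x∈J j∈hull with ∈-hull⁻ j∈hull
    ... | inj₁ j⊑x = member-ideal J∈M x∈J j⊑x
    ... | inj₂ (J′ , J′∈M , x∉J′ , (z , z∈J′ , z⊑x) , j∈J′)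
      with nested J′∈M J∈M z∈J′ (member-ideal J∈M x∈J z⊑x)
    ...   | inj₁ J′⊆J = J′⊆J j∈J′
    ...   | inj₂ J⊆J′ = ⊥-elim (x∉J′ (J⊆J′ x∈J))

    ⊆-hull : ∀ {x J w} → J L.∈ M → x ∉ J → w ∈ hull x → w ∈ J → J ⊆ hull x
    ⊆-hull {x} {J} {w} J∈M x∉J w∈hull w∈J with ∈-hull⁻ w∈hull
    ... | inj₁ w⊑x = λ j∈J → ∈-hull⁺ (inj₂ (J , J∈M , x∉J , (w , w∈J , w⊑x) , j∈J))
    ... | inj₂ (J′ , J′∈M , x∉J′ , (z , z∈J′ , z⊑x) , w∈J′) with nested J′∈M J∈M w∈J′ w∈J
    ...   | inj₁ J′⊆J = λ j∈J → ∈-hull⁺ (inj₂ (J , J∈M , x∉J , (z , J′⊆J z∈J′ , z⊑x) , j∈J))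
    ...   | inj₂ J⊆J′ = λ j∈J → ∈-hull⁺ (inj₂ (J′ , J′∈M , x∉J′ , (z , z∈J′ , z⊑x) , J⊆J′ j∈J))

    hull-nested : ∀ {x J w} → J L.∈ M → w ∈ hull x → w ∈ J → hull x ⊆ J ⊎ J ⊆ hull x
    hull-nested {x} {J} J∈M w∈hull w∈J with x ∈? J
    ... | yes x∈J = inj₁ (hull-⊆ J∈M x∈J)
    ... | no x∉J = inj₂ (⊆-hull J∈M x∉J w∈hull w∈J)

    walk-to-top : ∀ {x a} → a ∈ hull x → Walk _⊑_ ⟦ hull x ⟧ a x
    walk-to-top a∈hull with ∈-hull⁻ a∈hull
    ... | inj₁ a⊑x = Walk-map below⊆hull (hasse-walk a⊑x)
    ... | inj₂ (J , J∈M , x∉J , (z , z∈J , z⊑x) , a∈J) =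
      Walk-map (λ j∈J → ∈-hull⁺ (inj₂ (J , J∈M , x∉J , (z , z∈J , z⊑x) , j∈J)))
               (proj₂ (proj₂ (member-connected J∈M)) _ _ a∈J z∈J)
      ◅◅ Walk-map below⊆hull (hasse-walk z⊑x)

    hull-connected : ∀ x → IsConnectedOrderIdeal _⊑_ ⟦ hull x ⟧
    hull-connected x = (x , x∈hull) , ideal , λ a b a∈ b∈ → walk-to-top a∈ ◅◅ Walk-reverse b∈ (walk-to-top b∈)
      where
      ideal : IsOrderIdeal _⊑_ ⟦ hull x ⟧
      ideal a b a∈hull b⊑a with ∈-hull⁻ a∈hull
      ... | inj₁ a⊑x = below⊆hull (⊑-trans b⊑a a⊑x)
      ... | inj₂ (J , J∈M , x∉J , z , a∈J) = ∈-hull⁺ (inj₂ (J , J∈M , x∉J , z , member-ideal J∈M a∈J b⊑a))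

    hull-∈ : ∀ x → hull x L.∈ M
    hull-∈ x with anyᴸ? (hull x ≟ₛ_) M
    ... | yes hull∈M = hull∈M
    ... | no hull∉M = ⊥-elim (<-irrefl refl (maximum (hull x ∷ M) extended))
      where
      compatible : ∀ A B → A L.∈ hull x ∷ M → B L.∈ hull x ∷ M → ¬ IntersectNontrivially A B
      compatible A B (here refl) (here refl) = ¬IntersectNontrivially-refl A
      compatible A B (here refl) (there B∈M) = nested⇒¬IntersectNontrivially (hull-nested B∈M)
      compatible A B (there A∈M) (here refl) =
        nested⇒¬IntersectNontrivially (λ w∈A w∈hull → swap (hull-nested A∈M w∈hull w∈A))
      compatible A B (there A∈M) (there B∈M) = laminar A B A∈M B∈M
      extended : IsIndependentSet P (hull x ∷ M)
      extended = (¬Any⇒All¬ M hull∉M ∷ unique) , (hull-connected x ∷ connected) , compatible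

    ∈-member-avoiding : ∀ {x k} → k ∈ hull x → k ≢ x → ∃[ J ] (J L.∈ M × x ∉ J × k ∈ J)
    ∈-member-avoiding {x} {k} k∈hull k≢x with ∈-hull⁻ k∈hull
    ... | inj₁ k⊑x = hull k , hull-∈ k , x∉hull-k , x∈hull
      where
      x∉hull-k : x ∉ hull k
      x∉hull-k x∈hull-k with ∈-hull⁻ x∈hull-k
      ... | inj₁ x⊑k = k≢x (antisym k⊑x x⊑k)
      ... | inj₂ (J , J∈M , k∉J , _ , x∈J) = k∉J (member-ideal J∈M x∈J k⊑x)
    ... | inj₂ (J , J∈M , x∉J , _ , k∈J) = J , J∈M , x∉J , k∈J

    hull-label : ∀ x → Label M (hull x) x
    hull-label x k = only-x , λ { refl → x∈hull , x∉μ }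
      where
      x∉μ : ¬ μ M (hull x) x
      x∉μ (J , J∈M , (_ , y , y∈hull , y∉J) , x∈J) = y∉J (hull-⊆ J∈M x∈J y∈hull)
      only-x : k ∈ hull x × ¬ μ M (hull x) k → k ≡ x
      only-x (k∈hull , k∉μ) with k ≟ x
      ... | yes k≡x = k≡x
      ... | no k≢x with ∈-member-avoiding k∈hull k≢x
      ...   | J , J∈M , x∉J , k∈J = ⊥-elim (k∉μ (J , J∈M , (⊆-hull J∈M x∉J k∈hull k∈J , x , x∈hull , x∉J) , k∈J))

    labelled : ∀ i → ∃[ J ] (J L.∈ M × Label M J i)
    labelled i = hull i , hull-∈ i , hull-label i

lemma2p5 : (n : ℕ) (P : FinPoset n) (M : List (Subset n)) →
    IsMaximumIndependentSet P M → IsPForest P (≤F M)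
lemma2p5 n P M (independent , maximum) = Labelling.isPForest labelled
  where
  open IndependentSet P M independent
  labelled : ∀ i → ∃[ J ] (J L.∈ M × Label M J i)
  labelled i = decidable-stable (any∈? (λ J → label? M J i) M)
    (λ unlabelled → ¬¬-decidable (FinPoset._≤P_ P) (λ _⊑?_ → unlabelled (Hull.labelled maximum _⊑?_ i)))
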